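{- Let $r\ge 1$ and $n\ge 1$ be integers. Then $$\sum_{k=1}^n k!\,B_{n,k}\big(1!\,x_1,\,2!\,x_2,\,3!\,x_3,\dots,r!\,x_r,0,0,\dots\big)=n!\,F^{[r]}_{n+r-1}(x_1,\dots,x_r),$$ where the arguments $y_i$ of $B_{n,k}$ are $y_i=i!\,x_i$ for $i\le r$ and $y_i=0$ for $i>r$.
   Context: For an integer $r\ge 1$, the $r$-Fibonacci polynomial $F^{[r]}_m(x_1,\dots,x_r)$ is defined by $F^{[r]}_m=0$ for $0\le m<r-1$, $F^{[r]}_{r-1}=1$, and $F^{[r]}_m=\sum_{i=1}^r x_iF^{[r]}_{m-i}$ for $m\ge r$. The partial exponential Bell polynomial is $$B_{n,k}(y_1,\dots,y_{n-k+1})=\sum_{\substack{j_1+\cdots+j_{n-k+1}=k\\ j_1+2j_2+\cdots+(n-k+1)j_{n-k+1}=n}}\frac{n!}{j_1!\cdots j_{n-k+1}!}\Big(\frac{y_1}{1!}\Big)^{j_1}\Big(\frac{y_2}{2!}\Big)^{j_2}\cdots\Big(\frac{y_{n-k+1}}{(n-k+1)!}\Big)^{j_{n-k+1}}$$ (sum over nonnegative integers $j_i$). -}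

module Defs where

open import Data.Nat as ℕ using (ℕ; zero; suc; _∸_; _!; _≡ᵇ_; _<ᵇ_; _<?_)
open import Data.Nat.Properties using (_!≢0)
open import Data.Integer using (+_)
open import Data.Rational using (ℚ; 0ℚ; 1ℚ; _+_; _*_; _/_)
open import Data.Fin using (Fin; fromℕ<; toℕ)
open import Data.Vec as Vec using (Vec; []; _∷_)
open import Data.List as List using (List; []; _∷_; map; filterᵇ; upTo; foldr; concatMap)
open import Data.Bool using (Bool; if_then_else_; _∧_)
open import Relation.Nullary using (yes; no)

ℕtoℚ : ℕ → ℚ
ℕtoℚ n = + n / 1

inv! : ℕ → ℚ
inv! n = (+ 1 / (n !)) {{n !≢0}}

sumℚ : List ℚ → ℚ
sumℚ = foldr _+_ 0ℚ

prodℚ : List ℚ → ℚ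
prodℚ = foldr _*_ 1ℚ

powℚ : ℚ → ℕ → ℚ
powℚ p zero    = 1ℚ
powℚ p (suc e) = p * powℚ p e

-- Indexing conventions: variables x₁,…,x_r are given as  x : Fin r → ℚ,
-- with x_i = x (i-1).  `var x i` is x_i for 1 ≤ i ≤ r and 0 otherwise.

var : {r : ℕ} → (Fin r → ℚ) → ℕ → ℚ
var {r} x zero = 0ℚ
var {r} x (suc i) with i <? r
... | yes p = x (fromℕ< p)
... | no _  = 0ℚ

-- r-Fibonacci polynomial F^{[r]}_m(x₁,…,x_r), evaluated at x.
-- F_m = 0 (m < r-1), F_{r-1} = 1, F_m = Σ_{i=1}^r x_i F_{m-i} (m ≥ r).

nth0 : List ℚ → ℕ → ℚ
nth0 []       _       = 0ℚ
nth0 (a ∷ as) zero    = a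
nth0 (a ∷ as) (suc i) = nth0 as i

-- one step: given m and prev = [F_{m-1}, F_{m-2}, …, F_0], compute F_m
fibStep : (r : ℕ) → (Fin r → ℚ) → ℕ → List ℚ → ℚ
fibStep r x m prev =
  if m <ᵇ (r ∸ 1) then 0ℚ
  else if m ≡ᵇ (r ∸ 1) then 1ℚ
  else sumℚ (map (λ j → var x (suc j) * nth0 prev j) (upTo r))

mutual
  fibBelow : (r : ℕ) → (Fin r → ℚ) → ℕ → List ℚ
  fibBelow r x zero    = []
  fibBelow r x (suc m) = rFib r x m ∷ fibBelow r x m

  rFib : (r : ℕ) → (Fin r → ℚ) → ℕ → ℚ
  rFib r x m = fibStep r x m (fibBelow r x m)

-- Partial exponential Bell polynomial B_{n,k}(y₁,…,y_{n-k+1}),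
-- y given as a function ℕ → ℚ (only y 1, …, y (n-k+1) are used).

tuples : (len b : ℕ) → List (Vec ℕ len)
tuples zero    b = [] ∷ []
tuples (suc l) b = concatMap (λ a → map (a ∷_) (tuples l b)) (upTo (suc b))

-- Σ_i j_i and Σ_i i·j_i, where position p (from 0) carries index i = p+1
vsum : {l : ℕ} → Vec ℕ l → ℕ
vsum []       = 0
vsum (a ∷ as) = a ℕ.+ vsum as

wsumFrom : {l : ℕ} → ℕ → Vec ℕ l → ℕ
wsumFrom i []       = 0
wsumFrom i (a ∷ as) = i ℕ.* a ℕ.+ wsumFrom (suc i) as

termFrom : {l : ℕ} → (ℕ → ℚ) → ℕ → Vec ℕ l → ℚ
termFrom y i []       = 1ℚ
termFrom y i (a ∷ as) = inv! a * powℚ (y i * inv! i) a * termFrom y (suc i) as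

-- B_{n,k}(y₁,…,y_{n-k+1}): sum over (j₁,…,j_{n-k+1}) ∈ ℕ^{n-k+1} with
-- Σ j_i = k and Σ i j_i = n (each such j_i ≤ n, so entries range over 0..n)
bell : (n k : ℕ) → (ℕ → ℚ) → ℚ
bell n k y =
  sumℚ (map (λ j → ℕtoℚ (n !) * termFrom y 1 j)
            (filterᵇ (λ j → (vsum j ≡ᵇ k) ∧ (wsumFrom 1 j ≡ᵇ n))
                     (tuples (n ∸ k ℕ.+ 1) n)))

factVar : {r : ℕ} → (Fin r → ℚ) → ℕ → ℚ
factVar x i = ℕtoℚ (i !) * var x i

-- There are k!/(j₁! j₂! ⋯) compositions (ordered sequences of parts) of n into k parts in which the
-- part i occurs jᵢ times, so k!·B_{n,k}(y)/n! is the sum over all compositions n = p₁ + ⋯ + p_k of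
-- ∏ₜ y_{pₜ}/pₜ!. For y_p = p!·x_p, with x_p = 0 for p > r, the left-hand side is therefore n! times
-- the total weight ∏ₜ x_{pₜ} of all compositions of n. Splitting off the first part shows that these
-- totals satisfy T₀ = 1 and T_m = ∑_{p ≤ r} x_p T_{m-p}, the recurrence and initial values of F_{m+r-1}.
--
-- The multinomial count is established one part size i at a time: choosing which a of the K parts
-- equal i contributes the binomial K C a = K!/(a!(K-a)!).
module Submission where

open import Defs

module _ where
  open import Data.Bool using (Bool; true; false; T; if_then_else_; _∧_)
  open import Data.Empty using (⊥-elim)
  open import Data.Fin using (Fin)
  import Data.Integer as ℤ
  import Data.Integer.Properties as ℤₚ
  open import Data.List using (List; []; _∷_; _++_; map; upTo; applyUpTo; concatMap; filterᵇ)
  import Data.List.Properties as Listₚ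
  open import Data.Nat as ℕ
    using (ℕ; zero; suc; _≤_; _<_; z≤n; s≤s; _≤?_; _<?_; _∸_; _!; _≡ᵇ_; _<ᵇ_; NonZero)
  import Data.Nat.Properties as ℕₚ
  open import Data.Nat.Combinatorics
    using (_C_; nCk+nC[k+1]≡[n+1]C[k+1]; k>n⇒nCk≡0; nCk≡n!/k![n-k]!; k![n∸k]!∣n!)
  open import Data.Nat.Coprimality using (1-coprimeTo) renaming (sym to coprime-sym)
  open import Data.Nat.DivMod using (m*[n/m]≡n)
  open import Data.Nat.Induction using (<-rec)
  open import Data.Rational using (ℚ; mkℚ; 0ℚ; 1ℚ; _+_; _*_; _/_; toℚᵘ)
  import Data.Rational.Properties as ℚₚ
  import Data.Rational.Unnormalised as ℚᵘ
  import Data.Rational.Unnormalised.Properties as ℚᵘₚ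
  open import Data.Rational.Solver using (module +-*-Solver)
  open import Data.Vec using (Vec; []; _∷_)
  open import Function using (_∘_)
  open import Relation.Nullary using (yes; no; ¬_)
  open import Relation.Binary.PropositionalEquality hiding ([_])
  open +-*-Solver using (solve; _:=_; _:+_; _:*_)
  open ≡-Reasoning

  -- The embedding ℕ → ℚ

  ℕtoℚ≡mkℚ : ∀ n → ℕtoℚ n ≡ mkℚ (ℤ.+ n) 0 (coprime-sym (1-coprimeTo n))
  ℕtoℚ≡mkℚ n = ℚₚ.normalize-coprime (coprime-sym (1-coprimeTo n))

  toℚᵘ-ℕtoℚ : ∀ n → toℚᵘ (ℕtoℚ n) ≡ ℚᵘ.mkℚᵘ (ℤ.+ n) 0
  toℚᵘ-ℕtoℚ n = cong toℚᵘ (ℕtoℚ≡mkℚ n)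

  ℕtoℚ-homo-+ : ∀ a b → ℕtoℚ (a ℕ.+ b) ≡ ℕtoℚ a + ℕtoℚ b
  ℕtoℚ-homo-+ a b = ℚₚ.toℚᵘ-injective (ℚᵘₚ.≃-trans (ℚᵘₚ.≃-reflexive (toℚᵘ-ℕtoℚ (a ℕ.+ b)))
    (ℚᵘₚ.≃-trans (ℚᵘ.*≡* integers) (ℚᵘₚ.≃-sym (ℚᵘₚ.≃-trans (ℚₚ.toℚᵘ-homo-+ (ℕtoℚ a) (ℕtoℚ b))
      (ℚᵘₚ.≃-reflexive (cong₂ ℚᵘ._+_ (toℚᵘ-ℕtoℚ a) (toℚᵘ-ℕtoℚ b)))))))
    where
    integers : ℤ.+ (a ℕ.+ b) ℤ.* ℤ.+ 1 ≡ (ℤ.+ a ℤ.* ℤ.+ 1 ℤ.+ ℤ.+ b ℤ.* ℤ.+ 1) ℤ.* ℤ.+ 1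
    integers rewrite ℤₚ.*-identityʳ (ℤ.+ (a ℕ.+ b)) | ℤₚ.*-identityʳ (ℤ.+ a) | ℤₚ.*-identityʳ (ℤ.+ b)
                   | ℤₚ.*-identityʳ (ℤ.+ a ℤ.+ ℤ.+ b) = ℤₚ.pos-+ a b

  ℕtoℚ-homo-* : ∀ a b → ℕtoℚ (a ℕ.* b) ≡ ℕtoℚ a * ℕtoℚ b
  ℕtoℚ-homo-* a b = ℚₚ.toℚᵘ-injective (ℚᵘₚ.≃-trans (ℚᵘₚ.≃-reflexive (toℚᵘ-ℕtoℚ (a ℕ.* b)))
    (ℚᵘₚ.≃-trans (ℚᵘ.*≡* integers) (ℚᵘₚ.≃-sym (ℚᵘₚ.≃-trans (ℚₚ.toℚᵘ-homo-* (ℕtoℚ a) (ℕtoℚ b))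
      (ℚᵘₚ.≃-reflexive (cong₂ ℚᵘ._*_ (toℚᵘ-ℕtoℚ a) (toℚᵘ-ℕtoℚ b)))))))
    where
    integers : ℤ.+ (a ℕ.* b) ℤ.* ℤ.+ 1 ≡ (ℤ.+ a ℤ.* ℤ.+ b) ℤ.* ℤ.+ 1
    integers rewrite ℤₚ.*-identityʳ (ℤ.+ (a ℕ.* b)) | ℤₚ.*-identityʳ (ℤ.+ a ℤ.* ℤ.+ b) = ℤₚ.pos-* a b

  ℕtoℚ-0 : ℕtoℚ 0 ≡ 0ℚ
  ℕtoℚ-0 = ℕtoℚ≡mkℚ 0

  ℕtoℚ-1 : ℕtoℚ 1 ≡ 1ℚ
  ℕtoℚ-1 = ℕtoℚ≡mkℚ 1

  1/n*n≡1 : ∀ n .{{_ : NonZero n}} → (ℤ.+ 1 / n) * ℕtoℚ n ≡ 1ℚ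
  1/n*n≡1 (suc k) = trans (cong₂ _*_ (ℚₚ.normalize-coprime (1-coprimeTo (suc k))) (ℕtoℚ≡mkℚ (suc k)))
                          (ℚₚ.*-inverseˡ (mkℚ (ℤ.+ suc k) 0 (coprime-sym (1-coprimeTo (suc k)))))

  inv!-inverseˡ : ∀ n → inv! n * ℕtoℚ (n !) ≡ 1ℚ
  inv!-inverseˡ n = 1/n*n≡1 (n !) {{n ℕₚ.!≢0}}

  k![n∸k]!*nCk≡n! : ∀ {n k} → k ≤ n → (k ! ℕ.* (n ∸ k) !) ℕ.* (n C k) ≡ n !
  k![n∸k]!*nCk≡n! {n} {k} k≤n = trans (cong ((k ! ℕ.* (n ∸ k) !) ℕ.*_) (nCk≡n!/k![n-k]! k≤n))
                                      (m*[n/m]≡n {{k ℕₚ.!* (n ∸ k) !≢0}} (k![n∸k]!∣n! k≤n))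

  n!*inv!k≡nCk*[n∸k]! : ∀ {n k} → k ≤ n → ℕtoℚ (n !) * inv! k ≡ ℕtoℚ (n C k) * ℕtoℚ ((n ∸ k) !)
  n!*inv!k≡nCk*[n∸k]! {n} {k} k≤n = begin
      ℕtoℚ (n !) * inv! k
    ≡⟨ cong (λ m → ℕtoℚ m * inv! k) (k![n∸k]!*nCk≡n! k≤n) ⟨
      ℕtoℚ ((k ! ℕ.* (n ∸ k) !) ℕ.* (n C k)) * inv! k
    ≡⟨ cong (_* inv! k) (trans (ℕtoℚ-homo-* (k ! ℕ.* (n ∸ k) !) (n C k))
                               (cong (_* ℕtoℚ (n C k)) (ℕtoℚ-homo-* (k !) ((n ∸ k) !)))) ⟩
      ℕtoℚ (k !) * ℕtoℚ ((n ∸ k) !) * ℕtoℚ (n C k) * inv! k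
    ≡⟨ solve 4 (λ f g c v → f :* g :* c :* v := (v :* f) :* (c :* g)) refl
         (ℕtoℚ (k !)) (ℕtoℚ ((n ∸ k) !)) (ℕtoℚ (n C k)) (inv! k) ⟩
      (inv! k * ℕtoℚ (k !)) * (ℕtoℚ (n C k) * ℕtoℚ ((n ∸ k) !))
    ≡⟨ trans (cong (_* (ℕtoℚ (n C k) * ℕtoℚ ((n ∸ k) !))) (inv!-inverseˡ k)) (ℚₚ.*-identityˡ _) ⟩
      ℕtoℚ (n C k) * ℕtoℚ ((n ∸ k) !) ∎

  -- Finite sums

  ∑ : ℕ → (ℕ → ℚ) → ℚ
  ∑ zero    f = 0ℚ
  ∑ (suc n) f = f 0 + ∑ n (f ∘ suc)

  ∑-cong : ∀ n {f g : ℕ → ℚ} → (∀ a → a < n → f a ≡ g a) → ∑ n f ≡ ∑ n g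
  ∑-cong zero    f≗g = refl
  ∑-cong (suc n) f≗g = cong₂ _+_ (f≗g 0 (s≤s z≤n)) (∑-cong n (λ a a<n → f≗g (suc a) (s≤s a<n)))

  ∑-zero : ∀ n {f : ℕ → ℚ} → (∀ a → a < n → f a ≡ 0ℚ) → ∑ n f ≡ 0ℚ
  ∑-zero zero    f≗0 = refl
  ∑-zero (suc n) f≗0 = trans (cong₂ _+_ (f≗0 0 (s≤s z≤n)) (∑-zero n (λ a a<n → f≗0 (suc a) (s≤s a<n))))
                             (ℚₚ.+-identityˡ 0ℚ)

  ∑-distrib-+ : ∀ n (f g : ℕ → ℚ) → ∑ n (λ a → f a + g a) ≡ ∑ n f + ∑ n g
  ∑-distrib-+ zero    f g = sym (ℚₚ.+-identityˡ 0ℚ)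
  ∑-distrib-+ (suc n) f g = trans (cong ((f 0 + g 0) +_) (∑-distrib-+ n (f ∘ suc) (g ∘ suc)))
    (solve 4 (λ a b c d → (a :+ b) :+ (c :+ d) := (a :+ c) :+ (b :+ d)) refl
       (f 0) (g 0) (∑ n (f ∘ suc)) (∑ n (g ∘ suc)))

  *-distribˡ-∑ : ∀ n c (f : ℕ → ℚ) → c * ∑ n f ≡ ∑ n (λ a → c * f a)
  *-distribˡ-∑ zero    c f = ℚₚ.*-zeroʳ c
  *-distribˡ-∑ (suc n) c f =
    trans (ℚₚ.*-distribˡ-+ c (f 0) _) (cong (c * f 0 +_) (*-distribˡ-∑ n c (f ∘ suc)))

  ∑-++ : ∀ m k (f : ℕ → ℚ) → ∑ (m ℕ.+ k) f ≡ ∑ m f + ∑ k (λ a → f (m ℕ.+ a))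
  ∑-++ zero    k f = sym (ℚₚ.+-identityˡ _)
  ∑-++ (suc m) k f = trans (cong (f 0 +_) (∑-++ m k (f ∘ suc))) (sym (ℚₚ.+-assoc (f 0) _ _))

  ∑-comm : ∀ n m (f : ℕ → ℕ → ℚ) → ∑ n (λ a → ∑ m (f a)) ≡ ∑ m (λ b → ∑ n (λ a → f a b))
  ∑-comm zero    m f = sym (∑-zero m (λ _ _ → refl))
  ∑-comm (suc n) m f = trans (cong (∑ m (f 0) +_) (∑-comm n m (f ∘ suc)))
                             (sym (∑-distrib-+ m (f 0) (λ b → ∑ n (λ a → f (suc a) b))))

  ∑-extend : ∀ {m n} (f : ℕ → ℚ) → m ≤ n → (∀ a → m ≤ a → a < n → f a ≡ 0ℚ) → ∑ n f ≡ ∑ m f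
  ∑-extend {m} {n} f m≤n tail≗0 = begin
      ∑ n f                                   ≡⟨ cong (λ k → ∑ k f) (ℕₚ.m+[n∸m]≡n m≤n) ⟨
      ∑ (m ℕ.+ (n ∸ m)) f                     ≡⟨ ∑-++ m (n ∸ m) f ⟩
      ∑ m f + ∑ (n ∸ m) (λ a → f (m ℕ.+ a))  ≡⟨ cong (∑ m f +_) (∑-zero (n ∸ m) tail) ⟩
      ∑ m f + 0ℚ                              ≡⟨ ℚₚ.+-identityʳ (∑ m f) ⟩
      ∑ m f                                   ∎
    where
    tail : ∀ a → a < n ∸ m → f (m ℕ.+ a) ≡ 0ℚ
    tail a a<n∸m = tail≗0 (m ℕ.+ a) (ℕₚ.m≤m+n m a)
      (subst (m ℕ.+ a <_) (ℕₚ.m+[n∸m]≡n m≤n) (ℕₚ.+-monoʳ-< m a<n∸m))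

  sumℚ-++ : ∀ (xs ys : List ℚ) → sumℚ (xs ++ ys) ≡ sumℚ xs + sumℚ ys
  sumℚ-++ []       ys = sym (ℚₚ.+-identityˡ _)
  sumℚ-++ (x ∷ xs) ys = trans (cong (x +_) (sumℚ-++ xs ys)) (sym (ℚₚ.+-assoc x _ _))

  sumℚ-applyUpTo : ∀ n (f : ℕ → ℚ) (g : ℕ → ℕ) → sumℚ (map f (applyUpTo g n)) ≡ ∑ n (f ∘ g)
  sumℚ-applyUpTo zero    f g = refl
  sumℚ-applyUpTo (suc n) f g = cong (f (g 0) +_) (sumℚ-applyUpTo n f (g ∘ suc))

  sumℚ-upTo : ∀ n (f : ℕ → ℚ) → sumℚ (map f (upTo n)) ≡ ∑ n f
  sumℚ-upTo n f = sumℚ-applyUpTo n f (λ a → a)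

  sumℚ-map-cong : ∀ {A : Set} (xs : List A) {f g : A → ℚ} → (∀ x → f x ≡ g x) →
    sumℚ (map f xs) ≡ sumℚ (map g xs)
  sumℚ-map-cong xs f≗g = cong sumℚ (Listₚ.map-cong f≗g xs)

  *-distribˡ-sumℚ : ∀ {A : Set} (xs : List A) c (f : A → ℚ) →
    c * sumℚ (map f xs) ≡ sumℚ (map (λ x → c * f x) xs)
  *-distribˡ-sumℚ []       c f = ℚₚ.*-zeroʳ c
  *-distribˡ-sumℚ (x ∷ xs) c f =
    trans (ℚₚ.*-distribˡ-+ c (f x) _) (cong (c * f x +_) (*-distribˡ-sumℚ xs c f))

  sumℚ-concatMap : ∀ {A B : Set} (F : A → List B) (h : B → ℚ) (xs : List A) →
    sumℚ (map h (concatMap F xs)) ≡ sumℚ (map (λ a → sumℚ (map h (F a))) xs)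
  sumℚ-concatMap F h []       = refl
  sumℚ-concatMap F h (x ∷ xs) = begin
      sumℚ (map h (F x ++ concatMap F xs))            ≡⟨ cong sumℚ (Listₚ.map-++ h (F x) (concatMap F xs)) ⟩
      sumℚ (map h (F x) ++ map h (concatMap F xs))    ≡⟨ sumℚ-++ (map h (F x)) _ ⟩
      sumℚ (map h (F x)) + sumℚ (map h (concatMap F xs))
        ≡⟨ cong (sumℚ (map h (F x)) +_) (sumℚ-concatMap F h xs) ⟩
      sumℚ (map h (F x)) + sumℚ (map (λ a → sumℚ (map h (F a))) xs) ∎

  sumℚ-filterᵇ : ∀ {A : Set} (p : A → Bool) (f : A → ℚ) (xs : List A) →
    sumℚ (map f (filterᵇ p xs)) ≡ sumℚ (map (λ x → if p x then f x else 0ℚ) xs)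
  sumℚ-filterᵇ p f []       = refl
  sumℚ-filterᵇ p f (x ∷ xs) with p x
  ... | true  = cong (f x +_) (sumℚ-filterᵇ p f xs)
  ... | false = trans (sumℚ-filterᵇ p f xs) (sym (ℚₚ.+-identityˡ _))

  -- Guards every use of the truncated difference N ∸ m.
  [_≤_]_ : ℕ → ℕ → ℚ → ℚ
  [ m ≤ N ] q with m ≤? N
  ... | yes _ = q
  ... | no  _ = 0ℚ

  [≤]-elim : ∀ m N q t → (m ≤ N → q ≡ t) → (¬ m ≤ N → 0ℚ ≡ t) → [ m ≤ N ] q ≡ t
  [≤]-elim m N q t yes-case no-case with m ≤? N
  ... | yes m≤N = yes-case m≤N
  ... | no  m≰N = no-case m≰N

  [≤]-yes : ∀ {m N} q → m ≤ N → [ m ≤ N ] q ≡ q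
  [≤]-yes {m} {N} q m≤N = [≤]-elim m N q q (λ _ → refl) (λ m≰N → ⊥-elim (m≰N m≤N))

  [≤]-no : ∀ {m N} q → ¬ m ≤ N → [ m ≤ N ] q ≡ 0ℚ
  [≤]-no {m} {N} q m≰N = [≤]-elim m N q 0ℚ (λ m≤N → ⊥-elim (m≰N m≤N)) (λ _ → refl)

  [≤]-cong : ∀ m N {q t} → (m ≤ N → q ≡ t) → [ m ≤ N ] q ≡ [ m ≤ N ] t
  [≤]-cong m N {q} {t} q≡t = [≤]-elim m N q ([ m ≤ N ] t)
    (λ m≤N → trans (q≡t m≤N) (sym ([≤]-yes t m≤N))) (λ m≰N → sym ([≤]-no t m≰N))

  [≤]-0 : ∀ m N → [ m ≤ N ] 0ℚ ≡ 0ℚ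
  [≤]-0 m N = [≤]-elim m N 0ℚ 0ℚ (λ _ → refl) (λ _ → refl)

  [≤]-+ : ∀ m N q t → [ m ≤ N ] q + [ m ≤ N ] t ≡ [ m ≤ N ] (q + t)
  [≤]-+ m N q t with m ≤? N
  ... | yes _ = refl
  ... | no  _ = ℚₚ.+-identityˡ 0ℚ

  *-[≤] : ∀ m N c q → c * [ m ≤ N ] q ≡ [ m ≤ N ] (c * q)
  *-[≤] m N c q with m ≤? N
  ... | yes _ = refl
  ... | no  _ = ℚₚ.*-zeroʳ c

  [≤]-∑ : ∀ m N n (f : ℕ → ℚ) → [ m ≤ N ] ∑ n f ≡ ∑ n (λ a → [ m ≤ N ] f a)
  [≤]-∑ m N n f with m ≤? N
  ... | yes _ = refl
  ... | no  _ = sym (∑-zero n (λ _ _ → refl))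

  [≤]-sumℚ : ∀ {A : Set} m N (xs : List A) (f : A → ℚ) →
    [ m ≤ N ] sumℚ (map f xs) ≡ sumℚ (map (λ x → [ m ≤ N ] f x) xs)
  [≤]-sumℚ m N xs f with m ≤? N
  ... | yes _ = refl
  ... | no  _ = sym (sumℚ-0 xs)
    where
    sumℚ-0 : ∀ {A : Set} (ys : List A) → sumℚ (map (λ _ → 0ℚ) ys) ≡ 0ℚ
    sumℚ-0 []       = refl
    sumℚ-0 (_ ∷ ys) = trans (ℚₚ.+-identityˡ _) (sumℚ-0 ys)

  [≤]-[≤] : ∀ m k N q → [ m ≤ N ] ([ k ≤ N ∸ m ] q) ≡ [ m ℕ.+ k ≤ N ] q
  [≤]-[≤] m k N q with m ≤? N
  ... | no m≰N = sym ([≤]-no q (λ m+k≤N → m≰N (ℕₚ.m+n≤o⇒m≤o m m+k≤N)))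
  ... | yes m≤N with k ≤? N ∸ m
  ...   | yes k≤N∸m =
    sym ([≤]-yes q (subst (m ℕ.+ k ≤_) (ℕₚ.m+[n∸m]≡n m≤N) (ℕₚ.+-monoʳ-≤ m k≤N∸m)))
  ...   | no  k≰N∸m =
    sym ([≤]-no q (λ m+k≤N → k≰N∸m (ℕₚ.m+n≤o⇒m≤o∸n k (subst (_≤ N) (ℕₚ.+-comm m k) m+k≤N))))

  [≤]-comm : ∀ m k N q → [ m ≤ N ] ([ k ≤ N ∸ m ] q) ≡ [ k ≤ N ] ([ m ≤ N ∸ k ] q)
  [≤]-comm m k N q = trans ([≤]-[≤] m k N q)
    (trans (cong (λ s → [ s ≤ N ] q) (ℕₚ.+-comm m k)) (sym ([≤]-[≤] k m N q)))

  ∑-[≤]-* : ∀ n m N c (f : ℕ → ℚ) → ∑ n (λ a → [ m ≤ N ] (c * f a)) ≡ [ m ≤ N ] (c * ∑ n f)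
  ∑-[≤]-* n m N c f = begin
      ∑ n (λ a → [ m ≤ N ] (c * f a))   ≡⟨ [≤]-∑ m N n (λ a → c * f a) ⟨
      [ m ≤ N ] ∑ n (λ a → c * f a)     ≡⟨ cong ([ m ≤ N ]_) (*-distribˡ-∑ n c f) ⟨
      [ m ≤ N ] (c * ∑ n f)             ∎

  *-distribˡ-∑-[≤] : ∀ n c (m : ℕ → ℕ) M (f : ℕ → ℚ) →
    c * ∑ n (λ q → [ m q ≤ M ] f q) ≡ ∑ n (λ q → [ m q ≤ M ] (c * f q))
  *-distribˡ-∑-[≤] n c m M f = trans (*-distribˡ-∑ n c (λ q → [ m q ≤ M ] f q))
                                     (∑-cong n (λ q _ → *-[≤] (m q) M c (f q)))

  ∑-restrict : ∀ {K b} (f : ℕ → ℚ) → K ≤ b → ∑ (suc b) (λ a → [ a ≤ K ] f a) ≡ ∑ (suc K) f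
  ∑-restrict {K} {b} f K≤b = begin
      ∑ (suc b) (λ a → [ a ≤ K ] f a)
    ≡⟨ ∑-extend (λ a → [ a ≤ K ] f a) (s≤s K≤b) (λ a K<a _ → [≤]-no (f a) (ℕₚ.<⇒≱ K<a)) ⟩
      ∑ (suc K) (λ a → [ a ≤ K ] f a)
    ≡⟨ ∑-cong (suc K) (λ a a≤K → [≤]-yes (f a) (ℕₚ.≤-pred a≤K)) ⟩
      ∑ (suc K) f ∎

  -- Weighted compositions

  m∸n∸o≡m∸o∸n : ∀ m n o → m ∸ n ∸ o ≡ m ∸ o ∸ n
  m∸n∸o≡m∸o∸n m n o =
    trans (ℕₚ.∸-+-assoc m n o) (trans (cong (m ∸_) (ℕₚ.+-comm n o)) (sym (ℕₚ.∸-+-assoc m o n)))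

  n≤m⇒m<n+o⇒m∸n<o : ∀ {m n o} → n ≤ m → m < n ℕ.+ o → m ∸ n < o
  n≤m⇒m<n+o⇒m∸n<o {m} {n} {zero}  n≤m m<n+0 =
    ⊥-elim (ℕₚ.<⇒≱ (subst (m <_) (ℕₚ.+-identityʳ n) m<n+0) n≤m)
  n≤m⇒m<n+o⇒m∸n<o {m} {n} {suc o} n≤m m<n+o = ℕₚ.m<n+o⇒m∸n<o m n m<n+o

  module Compositions (z : ℕ → ℚ) where

    δ₀ : ℕ → ℚ
    δ₀ zero    = 1ℚ
    δ₀ (suc _) = 0ℚ

    -- comp i l N K sums ∏ₜ z pₜ over the compositions N = p₁ + ⋯ + p_K with parts in {i, …, i+l-1};
    -- the recursion splits off p₁.
    comp : (i l N K : ℕ) → ℚ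
    comp i l N zero    = δ₀ N
    comp i l N (suc K) = ∑ l (λ q → [ i ℕ.+ q ≤ N ] (z (i ℕ.+ q) * comp i l (N ∸ (i ℕ.+ q)) K))

    -- The a parts equal to i occupy one of k C a sets of positions (k = K in binomialSplit);
    -- the other K ∸ a parts lie in {i+1, …, i+l}.
    splitTerm : (i l N k K a : ℕ) → ℚ
    splitTerm i l N k K a =
      [ i ℕ.* a ≤ N ] (ℕtoℚ (k C a) * (powℚ (z i) a * comp (suc i) l (N ∸ i ℕ.* a) (K ∸ a)))

    binomialSplit : (i l N K : ℕ) → ℚ
    binomialSplit i l N K = ∑ (suc K) (splitTerm i l N K K)

    splitTerm-pascal : ∀ i l N K a →
      splitTerm i l N (suc K) (suc K) (suc a)
        ≡ [ i ≤ N ] (z i * splitTerm i l (N ∸ i) K K a) + splitTerm i l N K (suc K) (suc a)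
    splitTerm-pascal i l N K a = begin
        [ m ≤ N ] (ℕtoℚ (suc K C suc a) * X)
      ≡⟨ cong (λ c → [ m ≤ N ] (c * X)) pascal ⟩
        [ m ≤ N ] ((ℕtoℚ (K C a) + ℕtoℚ (K C suc a)) * X)
      ≡⟨ cong ([ m ≤ N ]_) (ℚₚ.*-distribʳ-+ X (ℕtoℚ (K C a)) (ℕtoℚ (K C suc a))) ⟩
        [ m ≤ N ] (ℕtoℚ (K C a) * X + ℕtoℚ (K C suc a) * X)
      ≡⟨ [≤]-+ m N (ℕtoℚ (K C a) * X) (ℕtoℚ (K C suc a) * X) ⟨
        [ m ≤ N ] (ℕtoℚ (K C a) * X) + splitTerm i l N K (suc K) (suc a)
      ≡⟨ cong (_+ splitTerm i l N K (suc K) (suc a)) first ⟨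
        [ i ≤ N ] (z i * splitTerm i l (N ∸ i) K K a) + splitTerm i l N K (suc K) (suc a) ∎
      where
      m = i ℕ.* suc a
      X = powℚ (z i) (suc a) * comp (suc i) l (N ∸ m) (K ∸ a)
      pascal : ℕtoℚ (suc K C suc a) ≡ ℕtoℚ (K C a) + ℕtoℚ (K C suc a)
      pascal = trans (cong ℕtoℚ (sym (nCk+nC[k+1]≡[n+1]C[k+1] K a))) (ℕtoℚ-homo-+ (K C a) (K C suc a))
      Y = λ t → ℕtoℚ (K C a) * (powℚ (z i) a * comp (suc i) l t (K ∸ a))
      first : [ i ≤ N ] (z i * splitTerm i l (N ∸ i) K K a) ≡ [ m ≤ N ] (ℕtoℚ (K C a) * X)
      first = begin
          [ i ≤ N ] (z i * [ i ℕ.* a ≤ N ∸ i ] Y (N ∸ i ∸ i ℕ.* a))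
        ≡⟨ cong ([ i ≤ N ]_) (*-[≤] (i ℕ.* a) (N ∸ i) (z i) (Y (N ∸ i ∸ i ℕ.* a))) ⟩
          [ i ≤ N ] ([ i ℕ.* a ≤ N ∸ i ] (z i * Y (N ∸ i ∸ i ℕ.* a)))
        ≡⟨ [≤]-[≤] i (i ℕ.* a) N (z i * Y (N ∸ i ∸ i ℕ.* a)) ⟩
          [ i ℕ.+ i ℕ.* a ≤ N ] (z i * Y (N ∸ i ∸ i ℕ.* a))
        ≡⟨ cong₂ (λ s t → [ s ≤ N ] (z i * Y t)) (sym (ℕₚ.*-suc i a))
                 (trans (ℕₚ.∸-+-assoc N i (i ℕ.* a)) (cong (N ∸_) (sym (ℕₚ.*-suc i a)))) ⟩
          [ m ≤ N ] (z i * Y (N ∸ m))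
        ≡⟨ cong ([ m ≤ N ]_) (solve 4 (λ w c p d → w :* (c :* (p :* d)) := c :* (w :* p :* d)) refl
             (z i) (ℕtoℚ (K C a)) (powℚ (z i) a) (comp (suc i) l (N ∸ m) (K ∸ a))) ⟩
          [ m ≤ N ] (ℕtoℚ (K C a) * X) ∎

    binomialSplit-suc : ∀ i l N K → binomialSplit i l N (suc K)
      ≡ [ i ≤ N ] (z i * binomialSplit i l (N ∸ i) K) + ∑ (suc (suc K)) (splitTerm i l N K (suc K))
    binomialSplit-suc i l N K = begin
        g 0 + ∑ (suc K) (λ a → splitTerm i l N (suc K) (suc K) (suc a))
      ≡⟨ cong (g 0 +_) (∑-cong (suc K) (λ a _ → splitTerm-pascal i l N K a)) ⟩
        g 0 + ∑ (suc K) (λ a → A a + g (suc a))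
      ≡⟨ cong (g 0 +_) (∑-distrib-+ (suc K) A (g ∘ suc)) ⟩
        g 0 + (∑ (suc K) A + ∑ (suc K) (g ∘ suc))
      ≡⟨ solve 3 (λ u v w → u :+ (v :+ w) := v :+ (u :+ w)) refl
           (g 0) (∑ (suc K) A) (∑ (suc K) (g ∘ suc)) ⟩
        ∑ (suc K) A + ∑ (suc (suc K)) g
      ≡⟨ cong (_+ ∑ (suc (suc K)) g) (∑-[≤]-* (suc K) i N (z i) (splitTerm i l (N ∸ i) K K)) ⟩
        [ i ≤ N ] (z i * binomialSplit i l (N ∸ i) K) + ∑ (suc (suc K)) g ∎
      where
      g : ℕ → ℚ
      g = splitTerm i l N K (suc K)
      A : ℕ → ℚ
      A a = [ i ≤ N ] (z i * splitTerm i l (N ∸ i) K K a)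

    splitTerm-unfold : ∀ i l N K a → a ≤ K →
      splitTerm i l N K (suc K) a
        ≡ ∑ l (λ q → [ suc i ℕ.+ q ≤ N ] (z (suc i ℕ.+ q) * splitTerm i l (N ∸ (suc i ℕ.+ q)) K K a))
    splitTerm-unfold i l N K a a≤K = begin
        [ i ℕ.* a ≤ N ] (c * (w * comp (suc i) l M (suc K ∸ a)))
      ≡⟨ cong (λ k → [ i ℕ.* a ≤ N ] (c * (w * comp (suc i) l M k))) (ℕₚ.+-∸-assoc 1 a≤K) ⟩
        [ i ℕ.* a ≤ N ] (c * (w * ∑ l (λ q → [ p q ≤ M ] f q)))
      ≡⟨ cong ([ i ℕ.* a ≤ N ]_) (trans (cong (c *_) (*-distribˡ-∑-[≤] l w p M f))
                                        (*-distribˡ-∑-[≤] l c p M (λ q → w * f q))) ⟩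
        [ i ℕ.* a ≤ N ] ∑ l (λ q → [ p q ≤ M ] (c * (w * f q)))
      ≡⟨ [≤]-∑ (i ℕ.* a) N l (λ q → [ p q ≤ M ] (c * (w * f q))) ⟩
        ∑ l (λ q → [ i ℕ.* a ≤ N ] ([ p q ≤ M ] (c * (w * f q))))
      ≡⟨ ∑-cong l (λ q _ → reorder q) ⟩
        ∑ l (λ q → [ p q ≤ N ] (z (p q) * splitTerm i l (N ∸ p q) K K a)) ∎
      where
      c = ℕtoℚ (K C a)
      w = powℚ (z i) a
      M = N ∸ i ℕ.* a
      p : ℕ → ℕ
      p q = suc i ℕ.+ q
      f : ℕ → ℚ
      f q = z (p q) * comp (suc i) l (M ∸ p q) (K ∸ a)
      reorder : ∀ q → [ i ℕ.* a ≤ N ] ([ p q ≤ M ] (c * (w * f q)))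
                    ≡ [ p q ≤ N ] (z (p q) * splitTerm i l (N ∸ p q) K K a)
      reorder q = begin
          [ i ℕ.* a ≤ N ] ([ p q ≤ M ] (c * (w * f q)))
        ≡⟨ [≤]-comm (i ℕ.* a) (p q) N (c * (w * f q)) ⟩
          [ p q ≤ N ] ([ i ℕ.* a ≤ N ∸ p q ] (c * (w * f q)))
        ≡⟨ cong (λ t → [ p q ≤ N ] ([ i ℕ.* a ≤ N ∸ p q ] (c * (w * (z (p q) * comp (suc i) l t (K ∸ a))))))
                (m∸n∸o≡m∸o∸n N (i ℕ.* a) (p q)) ⟩
          [ p q ≤ N ] ([ i ℕ.* a ≤ N ∸ p q ] (c * (w * (z (p q) * d))))
        ≡⟨ cong (λ t → [ p q ≤ N ] ([ i ℕ.* a ≤ N ∸ p q ] t))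
                (solve 4 (λ c w x d → c :* (w :* (x :* d)) := x :* (c :* (w :* d))) refl c w (z (p q)) d) ⟩
          [ p q ≤ N ] ([ i ℕ.* a ≤ N ∸ p q ] (z (p q) * (c * (w * d))))
        ≡⟨ cong ([ p q ≤ N ]_) (*-[≤] (i ℕ.* a) (N ∸ p q) (z (p q)) (c * (w * d))) ⟨
          [ p q ≤ N ] (z (p q) * splitTerm i l (N ∸ p q) K K a) ∎
        where
        d = comp (suc i) l (N ∸ p q ∸ i ℕ.* a) (K ∸ a)

    splitTerm-rest : ∀ i l N K → ∑ (suc (suc K)) (splitTerm i l N K (suc K))
      ≡ ∑ l (λ q → [ suc i ℕ.+ q ≤ N ] (z (suc i ℕ.+ q) * binomialSplit i l (N ∸ (suc i ℕ.+ q)) K))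
    splitTerm-rest i l N K = begin
        ∑ (suc (suc K)) g
      ≡⟨ ∑-extend g (ℕₚ.n≤1+n (suc K)) (λ a K<a _ → g-vanish a K<a) ⟩
        ∑ (suc K) g
      ≡⟨ ∑-cong (suc K) (λ a a≤K → splitTerm-unfold i l N K a (ℕₚ.≤-pred a≤K)) ⟩
        ∑ (suc K) (λ a → ∑ l (λ q → H q a))
      ≡⟨ ∑-comm (suc K) l (λ a q → H q a) ⟩
        ∑ l (λ q → ∑ (suc K) (H q))
      ≡⟨ ∑-cong l (λ q _ → ∑-[≤]-* (suc K) (p q) N (z (p q)) (splitTerm i l (N ∸ p q) K K)) ⟩
        ∑ l (λ q → [ p q ≤ N ] (z (p q) * binomialSplit i l (N ∸ p q) K)) ∎
      where
      g : ℕ → ℚ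
      g = splitTerm i l N K (suc K)
      p : ℕ → ℕ
      p q = suc i ℕ.+ q
      H : ℕ → ℕ → ℚ
      H q a = [ p q ≤ N ] (z (p q) * splitTerm i l (N ∸ p q) K K a)
      g-vanish : ∀ a → K < a → g a ≡ 0ℚ
      g-vanish a K<a = begin
          [ i ℕ.* a ≤ N ] (ℕtoℚ (K C a) * Y)
        ≡⟨ cong (λ c → [ i ℕ.* a ≤ N ] (c * Y)) (trans (cong ℕtoℚ (k>n⇒nCk≡0 K<a)) ℕtoℚ-0) ⟩
          [ i ℕ.* a ≤ N ] (0ℚ * Y)
        ≡⟨ cong ([ i ℕ.* a ≤ N ]_) (ℚₚ.*-zeroˡ Y) ⟩
          [ i ℕ.* a ≤ N ] 0ℚ
        ≡⟨ [≤]-0 (i ℕ.* a) N ⟩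
          0ℚ ∎
        where
        Y = powℚ (z i) a * comp (suc i) l (N ∸ i ℕ.* a) (suc K ∸ a)

    comp≡binomialSplit : ∀ i l K N → comp i (suc l) N K ≡ binomialSplit i l N K
    comp≡binomialSplit i l zero N = sym (begin
        [ i ℕ.* 0 ≤ N ] (ℕtoℚ 1 * (1ℚ * δ₀ (N ∸ i ℕ.* 0))) + 0ℚ
      ≡⟨ ℚₚ.+-identityʳ _ ⟩
        [ i ℕ.* 0 ≤ N ] (ℕtoℚ 1 * (1ℚ * δ₀ (N ∸ i ℕ.* 0)))
      ≡⟨ cong (λ m → [ m ≤ N ] (ℕtoℚ 1 * (1ℚ * δ₀ (N ∸ m)))) (ℕₚ.*-zeroʳ i) ⟩
        [ 0 ≤ N ] (ℕtoℚ 1 * (1ℚ * δ₀ N))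
      ≡⟨ [≤]-yes {0} {N} (ℕtoℚ 1 * (1ℚ * δ₀ N)) z≤n ⟩
        ℕtoℚ 1 * (1ℚ * δ₀ N)
      ≡⟨ trans (cong (_* (1ℚ * δ₀ N)) ℕtoℚ-1) (trans (ℚₚ.*-identityˡ _) (ℚₚ.*-identityˡ _)) ⟩
        δ₀ N ∎)
    comp≡binomialSplit i l (suc K) N = begin
        comp i (suc l) N (suc K)
      ≡⟨ cong₂ _+_ (shift (ℕₚ.+-identityʳ i)) (∑-cong l (λ q _ → shift (ℕₚ.+-suc i q))) ⟩
        t i + ∑ l (λ q → t (suc i ℕ.+ q))
      ≡⟨ cong (t i +_) (splitTerm-rest i l N K) ⟨
        t i + ∑ (suc (suc K)) (splitTerm i l N K (suc K))
      ≡⟨ binomialSplit-suc i l N K ⟨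
        binomialSplit i l N (suc K) ∎
      where
      t : ℕ → ℚ
      t s = [ s ≤ N ] (z s * binomialSplit i l (N ∸ s) K)
      shift : ∀ {s s′} → s ≡ s′ → [ s ≤ N ] (z s * comp i (suc l) (N ∸ s) K) ≡ t s′
      shift {s} refl = cong (λ w → [ s ≤ N ] (z s * w)) (comp≡binomialSplit i l K (N ∸ s))

    comp-vanish : ∀ l K M → M < K → comp 1 l M K ≡ 0ℚ
    comp-vanish l (suc K) M M<1+K = ∑-zero l (λ q _ → [≤]-elim (suc q) M _ 0ℚ
      (λ 1+q≤M → trans (cong (z (suc q) *_) (comp-vanish l K (M ∸ suc q)
                   (n≤m⇒m<n+o⇒m∸n<o 1+q≤M (ℕₚ.≤-trans M<1+K (s≤s (ℕₚ.m≤n+m K q))))))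
                 (ℚₚ.*-zeroʳ (z (suc q))))
      (λ _ → refl))

    comp-widen : ∀ K N l m → N < l ℕ.+ K → comp 1 (l ℕ.+ m) N K ≡ comp 1 l N K
    comp-widen zero    N l m _       = refl
    comp-widen (suc K) N l m N<l+1+K = begin
        ∑ (l ℕ.+ m) f
      ≡⟨ ∑-extend f (ℕₚ.m≤m+n l m) (λ q l≤q _ → large-part-vanishes q l≤q) ⟩
        ∑ l f
      ≡⟨ ∑-cong l (λ q _ → [≤]-cong (suc q) N (λ 1+q≤N → cong (z (suc q) *_)
           (comp-widen K (N ∸ suc q) l m
             (n≤m⇒m<n+o⇒m∸n<o 1+q≤N (ℕₚ.≤-trans N<1+l+K (s≤s (ℕₚ.m≤n+m (l ℕ.+ K) q))))))) ⟩
        comp 1 l N (suc K) ∎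
      where
      N<1+l+K : N < suc (l ℕ.+ K)
      N<1+l+K = subst (N <_) (ℕₚ.+-suc l K) N<l+1+K
      f : ℕ → ℚ
      f q = [ suc q ≤ N ] (z (suc q) * comp 1 (l ℕ.+ m) (N ∸ suc q) K)
      large-part-vanishes : ∀ q → l ≤ q → f q ≡ 0ℚ
      large-part-vanishes q l≤q = [≤]-elim (suc q) N _ 0ℚ
        (λ 1+q≤N → trans (cong (z (suc q) *_) (comp-vanish (l ℕ.+ m) K (N ∸ suc q)
                     (n≤m⇒m<n+o⇒m∸n<o 1+q≤N (ℕₚ.≤-trans N<1+l+K (s≤s (ℕₚ.+-monoˡ-≤ K l≤q))))))
                   (ℚₚ.*-zeroʳ (z (suc q))))
        (λ _ → refl)

    compTotal : ℕ → ℕ → ℚ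
    compTotal L M = ∑ (suc M) (comp 1 L M)

    compTotal-suc : ∀ L M →
      compTotal L (suc M) ≡ ∑ L (λ q → [ suc q ≤ suc M ] (z (suc q) * compTotal L (M ∸ q)))
    compTotal-suc L M = begin
        0ℚ + ∑ (suc M) (λ K → ∑ L (λ q → f q K))
      ≡⟨ ℚₚ.+-identityˡ _ ⟩
        ∑ (suc M) (λ K → ∑ L (λ q → f q K))
      ≡⟨ ∑-comm (suc M) L (λ K q → f q K) ⟩
        ∑ L (λ q → ∑ (suc M) (f q))
      ≡⟨ ∑-cong L (λ q _ → ∑-[≤]-* (suc M) (suc q) (suc M) (z (suc q)) (comp 1 L (M ∸ q))) ⟩
        ∑ L (λ q → [ suc q ≤ suc M ] (z (suc q) * ∑ (suc M) (comp 1 L (M ∸ q))))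
      ≡⟨ ∑-cong L (λ q _ → cong (λ w → [ suc q ≤ suc M ] (z (suc q) * w))
           (∑-extend (comp 1 L (M ∸ q)) (s≤s (ℕₚ.m∸n≤m M q))
                     (λ K M∸q<K _ → comp-vanish L K (M ∸ q) M∸q<K))) ⟩
        ∑ L (λ q → [ suc q ≤ suc M ] (z (suc q) * compTotal L (M ∸ q))) ∎
      where
      f : ℕ → ℕ → ℚ
      f q K = [ suc q ≤ suc M ] (z (suc q) * comp 1 L (M ∸ q) K)

  -- The Bell sum, one index at a time

  ≡ᵇ-cong : ∀ {m n m′ n′} → (m ≡ n → m′ ≡ n′) → (m′ ≡ n′ → m ≡ n) → (m ≡ᵇ n) ≡ (m′ ≡ᵇ n′)
  ≡ᵇ-cong {m} {n} {m′} {n′} to from with m ≡ᵇ n in eq | m′ ≡ᵇ n′ in eq′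
  ... | true  | true  = refl
  ... | false | false = refl
  ... | true  | false with () ← subst T eq′ (ℕₚ.≡⇒≡ᵇ m′ n′ (to (ℕₚ.≡ᵇ⇒≡ m n (subst T (sym eq) _))))
  ... | false | true  with () ← subst T eq (ℕₚ.≡⇒≡ᵇ m n (from (ℕₚ.≡ᵇ⇒≡ m′ n′ (subst T (sym eq′) _))))

  ≡ᵇ-false : ∀ {m n} → ¬ m ≡ n → (m ≡ᵇ n) ≡ false
  ≡ᵇ-false {m} {n} m≢n with m ≡ᵇ n in eq
  ... | false = refl
  ... | true  = ⊥-elim (m≢n (ℕₚ.≡ᵇ⇒≡ m n (subst T (sym eq) _)))

  +≡ᵇ-cancelˡ : ∀ {a s K} → a ≤ K → (a ℕ.+ s ≡ᵇ K) ≡ (s ≡ᵇ K ∸ a)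
  +≡ᵇ-cancelˡ {a} {s} a≤K = ≡ᵇ-cong (λ e → trans (sym (ℕₚ.m+n∸m≡n a s)) (cong (_∸ a) e))
                                    (λ e → trans (cong (a ℕ.+_) e) (ℕₚ.m+[n∸m]≡n a≤K))

  +≡ᵇ-false : ∀ {a s K} → ¬ a ≤ K → (a ℕ.+ s ≡ᵇ K) ≡ false
  +≡ᵇ-false {a} {s} a≰K = ≡ᵇ-false (λ e → a≰K (subst (a ≤_) e (ℕₚ.m≤m+n a s)))

  if-+≡ᵇ∧+≡ᵇ : ∀ a s K m w N c t →
    (if (a ℕ.+ s ≡ᵇ K) ∧ (m ℕ.+ w ≡ᵇ N) then c * t else 0ℚ)
      ≡ [ a ≤ K ] ([ m ≤ N ] (c * (if (s ≡ᵇ K ∸ a) ∧ (w ≡ᵇ N ∸ m) then t else 0ℚ)))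
  if-+≡ᵇ∧+≡ᵇ a s K m w N c t with a ≤? K
  ... | no a≰K rewrite +≡ᵇ-false {a} {s} a≰K = refl
  ... | yes a≤K with m ≤? N
  ...   | yes m≤N rewrite +≡ᵇ-cancelˡ {a} {s} a≤K | +≡ᵇ-cancelˡ {m} {w} m≤N
                  with (s ≡ᵇ K ∸ a) ∧ (w ≡ᵇ N ∸ m)
  ...     | true  = refl
  ...     | false = sym (ℚₚ.*-zeroʳ c)
  if-+≡ᵇ∧+≡ᵇ a s K m w N c t | yes a≤K | no m≰N rewrite +≡ᵇ-false {m} {w} m≰N with a ℕ.+ s ≡ᵇ K
  ... | true  = refl
  ... | false = refl

  module BellSums (y : ℕ → ℚ) where

    selected : ∀ {l} → (K N i : ℕ) → Vec ℕ l → Bool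
    selected K N i j = (vsum j ≡ᵇ K) ∧ (wsumFrom i j ≡ᵇ N)

    bellPart : (l b i N K : ℕ) → ℚ
    bellPart l b i N K = sumℚ (map (λ j → if selected K N i j then termFrom y i j else 0ℚ) (tuples l b))

    bell≡n!*bellPart : ∀ n K → bell n K y ≡ ℕtoℚ (n !) * bellPart (n ∸ K ℕ.+ 1) n 1 n K
    bell≡n!*bellPart n K = begin
        sumℚ (map (λ j → ℕtoℚ (n !) * termFrom y 1 j) (filterᵇ (selected K n 1) ts))
      ≡⟨ sumℚ-filterᵇ (selected K n 1) (λ j → ℕtoℚ (n !) * termFrom y 1 j) ts ⟩
        sumℚ (map (λ j → if selected K n 1 j then ℕtoℚ (n !) * termFrom y 1 j else 0ℚ) ts)
      ≡⟨ sumℚ-map-cong ts if-* ⟩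
        sumℚ (map (λ j → ℕtoℚ (n !) * h j) ts)
      ≡⟨ *-distribˡ-sumℚ ts (ℕtoℚ (n !)) h ⟨
        ℕtoℚ (n !) * bellPart (n ∸ K ℕ.+ 1) n 1 n K ∎
      where
      ts = tuples (n ∸ K ℕ.+ 1) n
      h : Vec ℕ (n ∸ K ℕ.+ 1) → ℚ
      h j = if selected K n 1 j then termFrom y 1 j else 0ℚ
      if-* : ∀ j → (if selected K n 1 j then ℕtoℚ (n !) * termFrom y 1 j else 0ℚ) ≡ ℕtoℚ (n !) * h j
      if-* j with selected K n 1 j
      ... | true  = refl
      ... | false = sym (ℚₚ.*-zeroʳ (ℕtoℚ (n !)))

    bellPart-suc : ∀ l b i N K → bellPart (suc l) b i N K
      ≡ ∑ (suc b) (λ a → [ a ≤ K ] ([ i ℕ.* a ≤ N ]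
          (inv! a * powℚ (y i * inv! i) a * bellPart l b (suc i) (N ∸ i ℕ.* a) (K ∸ a))))
    bellPart-suc l b i N K = begin
        sumℚ (map h (concatMap (λ a → map (a ∷_) ts) (upTo (suc b))))
      ≡⟨ sumℚ-concatMap (λ a → map (a ∷_) ts) h (upTo (suc b)) ⟩
        sumℚ (map (λ a → sumℚ (map h (map (a ∷_) ts))) (upTo (suc b)))
      ≡⟨ sumℚ-upTo (suc b) (λ a → sumℚ (map h (map (a ∷_) ts))) ⟩
        ∑ (suc b) (λ a → sumℚ (map h (map (a ∷_) ts)))
      ≡⟨ ∑-cong (suc b) (λ a _ → first-entry a) ⟩
        ∑ (suc b) (λ a → [ a ≤ K ] ([ i ℕ.* a ≤ N ] (c a * bellPart l b (suc i) (N ∸ i ℕ.* a) (K ∸ a)))) ∎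
      where
      ts = tuples l b
      h : Vec ℕ (suc l) → ℚ
      h j = if selected K N i j then termFrom y i j else 0ℚ
      c : ℕ → ℚ
      c a = inv! a * powℚ (y i * inv! i) a
      first-entry : ∀ a → sumℚ (map h (map (a ∷_) ts))
        ≡ [ a ≤ K ] ([ i ℕ.* a ≤ N ] (c a * bellPart l b (suc i) (N ∸ i ℕ.* a) (K ∸ a)))
      first-entry a = begin
          sumℚ (map h (map (a ∷_) ts))
        ≡⟨ cong sumℚ (Listₚ.map-∘ {g = h} {f = a ∷_} ts) ⟨
          sumℚ (map (λ j → h (a ∷ j)) ts)
        ≡⟨ sumℚ-map-cong ts (λ j → if-+≡ᵇ∧+≡ᵇ a (vsum j) K (i ℕ.* a) (wsumFrom (suc i) j) N
                                                (c a) (termFrom y (suc i) j)) ⟩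
          sumℚ (map (λ j → [ a ≤ K ] ([ i ℕ.* a ≤ N ] (c a * h′ j))) ts)
        ≡⟨ [≤]-sumℚ a K ts (λ j → [ i ℕ.* a ≤ N ] (c a * h′ j)) ⟨
          [ a ≤ K ] sumℚ (map (λ j → [ i ℕ.* a ≤ N ] (c a * h′ j)) ts)
        ≡⟨ cong ([ a ≤ K ]_) ([≤]-sumℚ (i ℕ.* a) N ts (λ j → c a * h′ j)) ⟨
          [ a ≤ K ] ([ i ℕ.* a ≤ N ] sumℚ (map (λ j → c a * h′ j) ts))
        ≡⟨ cong (λ t → [ a ≤ K ] ([ i ℕ.* a ≤ N ] t)) (*-distribˡ-sumℚ ts (c a) h′) ⟨
          [ a ≤ K ] ([ i ℕ.* a ≤ N ] (c a * bellPart l b (suc i) (N ∸ i ℕ.* a) (K ∸ a))) ∎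
        where
        h′ : Vec ℕ l → ℚ
        h′ j = if selected (K ∸ a) (N ∸ i ℕ.* a) (suc i) j then termFrom y (suc i) j else 0ℚ

  module BellToCompositions (y z : ℕ → ℚ) (y/i!≡z : ∀ i → y i * inv! i ≡ z i) where
    open BellSums y
    open Compositions z

    K!*bellPart≡comp : ∀ {b} l i N K → K ≤ b → ℕtoℚ (K !) * bellPart l b i N K ≡ comp i l N K
    K!*bellPart≡comp zero i zero    zero    _ =
      trans ℕtoℚ-1 (trans (ℚₚ.*-identityˡ _) (ℚₚ.+-identityʳ _))
    K!*bellPart≡comp zero i (suc N) zero    _ =
      trans (cong (ℕtoℚ 1 *_) (ℚₚ.+-identityʳ 0ℚ)) (ℚₚ.*-zeroʳ (ℕtoℚ 1))
    K!*bellPart≡comp zero i N       (suc K) _ =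
      trans (cong (ℕtoℚ (suc K !) *_) (ℚₚ.+-identityʳ 0ℚ)) (ℚₚ.*-zeroʳ (ℕtoℚ (suc K !)))
    K!*bellPart≡comp {b} (suc l) i N K K≤b = begin
        ℕtoℚ (K !) * bellPart (suc l) b i N K
      ≡⟨ cong (ℕtoℚ (K !) *_) (bellPart-suc l b i N K) ⟩
        ℕtoℚ (K !) * ∑ (suc b) (λ a → [ a ≤ K ] ([ i ℕ.* a ≤ N ] Q a))
      ≡⟨ *-distribˡ-∑-[≤] (suc b) (ℕtoℚ (K !)) (λ a → a) K (λ a → [ i ℕ.* a ≤ N ] Q a) ⟩
        ∑ (suc b) (λ a → [ a ≤ K ] (ℕtoℚ (K !) * [ i ℕ.* a ≤ N ] Q a))
      ≡⟨ ∑-restrict (λ a → ℕtoℚ (K !) * [ i ℕ.* a ≤ N ] Q a) K≤b ⟩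
        ∑ (suc K) (λ a → ℕtoℚ (K !) * [ i ℕ.* a ≤ N ] Q a)
      ≡⟨ ∑-cong (suc K) (λ a a<1+K → trans (*-[≤] (i ℕ.* a) N (ℕtoℚ (K !)) (Q a))
           (cong ([ i ℕ.* a ≤ N ]_) (term a (ℕₚ.≤-pred a<1+K)))) ⟩
        binomialSplit i l N K
      ≡⟨ comp≡binomialSplit i l K N ⟨
        comp i (suc l) N K ∎
      where
      B : ℕ → ℚ
      B a = bellPart l b (suc i) (N ∸ i ℕ.* a) (K ∸ a)
      Q : ℕ → ℚ
      Q a = inv! a * powℚ (y i * inv! i) a * B a
      term : ∀ a → a ≤ K →
        ℕtoℚ (K !) * Q a ≡ ℕtoℚ (K C a) * (powℚ (z i) a * comp (suc i) l (N ∸ i ℕ.* a) (K ∸ a))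
      term a a≤K = begin
          ℕtoℚ (K !) * (inv! a * powℚ (y i * inv! i) a * B a)
        ≡⟨ cong (λ w → ℕtoℚ (K !) * (inv! a * powℚ w a * B a)) (y/i!≡z i) ⟩
          ℕtoℚ (K !) * (inv! a * powℚ (z i) a * B a)
        ≡⟨ solve 4 (λ f v w t → f :* (v :* w :* t) := (f :* v) :* (w :* t)) refl
             (ℕtoℚ (K !)) (inv! a) (powℚ (z i) a) (B a) ⟩
          ℕtoℚ (K !) * inv! a * (powℚ (z i) a * B a)
        ≡⟨ cong (_* (powℚ (z i) a * B a)) (n!*inv!k≡nCk*[n∸k]! a≤K) ⟩
          ℕtoℚ (K C a) * ℕtoℚ ((K ∸ a) !) * (powℚ (z i) a * B a)
        ≡⟨ solve 4 (λ c f w t → c :* f :* (w :* t) := c :* (w :* (f :* t))) refl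
             (ℕtoℚ (K C a)) (ℕtoℚ ((K ∸ a) !)) (powℚ (z i) a) (B a) ⟩
          ℕtoℚ (K C a) * (powℚ (z i) a * (ℕtoℚ ((K ∸ a) !) * B a))
        ≡⟨ cong (λ w → ℕtoℚ (K C a) * (powℚ (z i) a * w))
             (K!*bellPart≡comp l (suc i) (N ∸ i ℕ.* a) (K ∸ a) (ℕₚ.≤-trans (ℕₚ.m∸n≤m K a) K≤b)) ⟩
          ℕtoℚ (K C a) * (powℚ (z i) a * comp (suc i) l (N ∸ i ℕ.* a) (K ∸ a)) ∎

    k!*bell≡n!*comp : ∀ n k → k < n →
      ℕtoℚ (suc k !) * bell n (suc k) y ≡ ℕtoℚ (n !) * comp 1 n n (suc k)
    k!*bell≡n!*comp n k k<n = begin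
        ℕtoℚ (suc k !) * bell n (suc k) y
      ≡⟨ cong (ℕtoℚ (suc k !) *_) (bell≡n!*bellPart n (suc k)) ⟩
        ℕtoℚ (suc k !) * (ℕtoℚ (n !) * bellPart l n 1 n (suc k))
      ≡⟨ solve 3 (λ f g t → f :* (g :* t) := g :* (f :* t)) refl
           (ℕtoℚ (suc k !)) (ℕtoℚ (n !)) (bellPart l n 1 n (suc k)) ⟩
        ℕtoℚ (n !) * (ℕtoℚ (suc k !) * bellPart l n 1 n (suc k))
      ≡⟨ cong (ℕtoℚ (n !) *_) (K!*bellPart≡comp l 1 n (suc k) k<n) ⟩
        ℕtoℚ (n !) * comp 1 l n (suc k)
      ≡⟨ cong (ℕtoℚ (n !) *_) (comp-widen (suc k) n l k n<l+1+k) ⟨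
        ℕtoℚ (n !) * comp 1 (l ℕ.+ k) n (suc k)
      ≡⟨ cong (λ m → ℕtoℚ (n !) * comp 1 m n (suc k)) l+k≡n ⟩
        ℕtoℚ (n !) * comp 1 n n (suc k) ∎
      where
      l = n ∸ suc k ℕ.+ 1
      l+k≡n : l ℕ.+ k ≡ n
      l+k≡n = trans (ℕₚ.+-assoc (n ∸ suc k) 1 k) (ℕₚ.m∸n+n≡m k<n)
      n<l+1+k : n < l ℕ.+ suc k
      n<l+1+k = subst (n <_) (sym (trans (ℕₚ.+-suc l k) (cong suc l+k≡n))) ℕₚ.≤-refl

  -- r-Fibonacci polynomials

  T⇒≡true : ∀ {b} → T b → b ≡ true
  T⇒≡true {true} _ = refl

  ¬T⇒≡false : ∀ {b} → ¬ T b → b ≡ false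
  ¬T⇒≡false {false} _  = refl
  ¬T⇒≡false {true}  ¬t = ⊥-elim (¬t _)

  factVar*inv!≡var : ∀ {r} (x : Fin r → ℚ) i → factVar x i * inv! i ≡ var x i
  factVar*inv!≡var x i = begin
      ℕtoℚ (i !) * var x i * inv! i     ≡⟨ solve 3 (λ f v w → f :* v :* w := (w :* f) :* v) refl
                                             (ℕtoℚ (i !)) (var x i) (inv! i) ⟩
      inv! i * ℕtoℚ (i !) * var x i     ≡⟨ cong (_* var x i) (inv!-inverseˡ i) ⟩
      1ℚ * var x i                      ≡⟨ ℚₚ.*-identityˡ (var x i) ⟩
      var x i                           ∎

  module RFibonacci (r′ : ℕ) (x : Fin (suc r′) → ℚ) where
    open Compositions (var x)

    r : ℕ
    r = suc r′

    F : ℕ → ℚ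
    F = rFib r x

    nth0-fibBelow : ∀ m j → j < m → nth0 (fibBelow r x m) j ≡ F (m ∸ suc j)
    nth0-fibBelow (suc m) zero    _         = refl
    nth0-fibBelow (suc m) (suc j) (s≤s j<m) = nth0-fibBelow m j j<m

    F-below : ∀ m → m < r′ → F m ≡ 0ℚ
    F-below m m<r′ rewrite T⇒≡true (ℕₚ.<⇒<ᵇ m<r′) = refl

    F-start : F r′ ≡ 1ℚ
    F-start rewrite ¬T⇒≡false {r′ <ᵇ r′} (λ t → ℕₚ.<-irrefl refl (ℕₚ.<ᵇ⇒< r′ r′ t))
                  | T⇒≡true (ℕₚ.≡⇒≡ᵇ r′ r′ refl) = refl

    F-rec : ∀ m → r′ < m → F m ≡ ∑ r (λ j → var x (suc j) * F (m ∸ suc j))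
    F-rec m r′<m rewrite ¬T⇒≡false {m <ᵇ r′} (λ t → ℕₚ.<-asym r′<m (ℕₚ.<ᵇ⇒< m r′ t))
                       | ¬T⇒≡false {m ≡ᵇ r′} (λ t → ℕₚ.<-irrefl (sym (ℕₚ.≡ᵇ⇒≡ m r′ t)) r′<m) =
      trans (sumℚ-upTo r (λ j → var x (suc j) * nth0 (fibBelow r x m) j))
            (∑-cong r (λ j j<r → cong (var x (suc j) *_) (nth0-fibBelow m j (ℕₚ.≤-trans j<r r′<m))))

    var-vanish : ∀ q → r ≤ q → var x (suc q) ≡ 0ℚ
    var-vanish q r≤q with q <? r
    ... | yes q<r = ⊥-elim (ℕₚ.<⇒≱ q<r r≤q)
    ... | no  _   = refl

    F-rec-guarded : ∀ L M → suc M ≤ L →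
      ∑ L (λ q → [ suc q ≤ suc M ] (var x (suc q) * F (M ∸ q ℕ.+ r′))) ≡ F (suc M ℕ.+ r′)
    F-rec-guarded L M M<L = begin
        ∑ L h
      ≡⟨ ∑-extend h (ℕₚ.m≤n+m L r) (λ q L≤q _ → h-vanish q L≤q) ⟨
        ∑ (r ℕ.+ L) h
      ≡⟨ ∑-cong (r ℕ.+ L) (λ q _ → h≡k q) ⟩
        ∑ (r ℕ.+ L) k
      ≡⟨ ∑-extend k (ℕₚ.m≤m+n r L) (λ q r≤q _ → k-vanish-≥r q r≤q) ⟩
        ∑ r k
      ≡⟨ F-rec (suc M ℕ.+ r′) (s≤s (ℕₚ.m≤n+m r′ M)) ⟨
        F (suc M ℕ.+ r′) ∎
      where
      h k : ℕ → ℚ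
      h q = [ suc q ≤ suc M ] (var x (suc q) * F (M ∸ q ℕ.+ r′))
      k q = var x (suc q) * F (M ℕ.+ r′ ∸ q)
      h-vanish : ∀ q → L ≤ q → h q ≡ 0ℚ
      h-vanish q L≤q = [≤]-no _ (λ 1+q≤1+M → ℕₚ.<⇒≱ M<L (ℕₚ.≤-trans L≤q (ℕₚ.≤-pred 1+q≤1+M)))
      k-vanish-≥r : ∀ q → r ≤ q → k q ≡ 0ℚ
      k-vanish-≥r q r≤q =
        trans (cong (_* F (M ℕ.+ r′ ∸ q)) (var-vanish q r≤q)) (ℚₚ.*-zeroˡ (F (M ℕ.+ r′ ∸ q)))
      -- a term of the recurrence beyond M is killed either by x_{q+1} = 0 (q ≥ r) or by F = 0 below r′
      k-vanish : ∀ q → ¬ suc q ≤ suc M → k q ≡ 0ℚ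
      k-vanish q 1+q≰1+M with r ≤? q
      ... | yes r≤q = k-vanish-≥r q r≤q
      ... | no  r≰q = trans (cong (var x (suc q) *_) (F-below (M ℕ.+ r′ ∸ q)
                        (n≤m⇒m<n+o⇒m∸n<o q≤M+r′ (ℕₚ.+-monoˡ-< r′ (ℕₚ.≰⇒> (1+q≰1+M ∘ s≤s))))))
                      (ℚₚ.*-zeroʳ (var x (suc q)))
        where
        q≤M+r′ : q ≤ M ℕ.+ r′
        q≤M+r′ = ℕₚ.≤-trans (ℕₚ.≤-pred (ℕₚ.≰⇒> r≰q)) (ℕₚ.m≤n+m r′ M)
      h≡k : ∀ q → h q ≡ k q
      h≡k q = [≤]-elim (suc q) (suc M) _ (k q)
        (λ 1+q≤1+M → cong (λ w → var x (suc q) * F w) (sym (ℕₚ.+-∸-comm r′ (ℕₚ.≤-pred 1+q≤1+M))))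
        (λ 1+q≰1+M → sym (k-vanish q 1+q≰1+M))

    compTotal≡F : ∀ L M → M ≤ L → compTotal L M ≡ F (M ℕ.+ r′)
    compTotal≡F L = <-rec (λ M → M ≤ L → compTotal L M ≡ F (M ℕ.+ r′)) step
      where
      step : ∀ M → (∀ {m} → m < M → m ≤ L → compTotal L m ≡ F (m ℕ.+ r′)) →
             M ≤ L → compTotal L M ≡ F (M ℕ.+ r′)
      step zero    _  _   = trans (ℚₚ.+-identityʳ 1ℚ) (sym F-start)
      step (suc M) ih M<L = begin
          compTotal L (suc M)
        ≡⟨ compTotal-suc L M ⟩
          ∑ L (λ q → [ suc q ≤ suc M ] (var x (suc q) * compTotal L (M ∸ q)))
        ≡⟨ ∑-cong L (λ q _ → cong (λ w → [ suc q ≤ suc M ] (var x (suc q) * w))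
             (ih (s≤s (ℕₚ.m∸n≤m M q)) (ℕₚ.≤-trans (ℕₚ.m∸n≤m M q) (ℕₚ.<⇒≤ M<L)))) ⟩
          ∑ L (λ q → [ suc q ≤ suc M ] (var x (suc q) * F (M ∸ q ℕ.+ r′)))
        ≡⟨ F-rec-guarded L M M<L ⟩
          F (suc M ℕ.+ r′) ∎

open import Data.Nat using (ℕ; suc; _+_; _∸_; _≥_; _!)
open import Data.Fin using (Fin)
open import Data.List using (map; upTo)
open import Data.Rational using (ℚ; _*_)
open import Relation.Binary.PropositionalEquality using (_≡_; cong; sym; trans; module ≡-Reasoning)
import Data.Nat.Properties as ℕₚ
import Data.Rational.Properties as ℚₚ

theorem5p6 : (r n : ℕ) → r ≥ 1 → n ≥ 1 → (x : Fin r → ℚ) →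
    sumℚ (map (λ k → ℕtoℚ (suc k !) * bell n (suc k) (factVar x)) (upTo n))
    ≡ ℕtoℚ (n !) * rFib r x (n + r ∸ 1)
theorem5p6 (suc r′) n@(suc _) _ _ x = begin
    sumℚ (map (λ k → ℕtoℚ (suc k !) * bell n (suc k) (factVar x)) (upTo n))
  ≡⟨ sumℚ-upTo n (λ k → ℕtoℚ (suc k !) * bell n (suc k) (factVar x)) ⟩
    ∑ n (λ k → ℕtoℚ (suc k !) * bell n (suc k) (factVar x))
  ≡⟨ ∑-cong n (λ k k<n → k!*bell≡n!*comp n k k<n) ⟩
    ∑ n (λ k → ℕtoℚ (n !) * comp 1 n n (suc k))
  ≡⟨ *-distribˡ-∑ n (ℕtoℚ (n !)) (λ k → comp 1 n n (suc k)) ⟨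
    ℕtoℚ (n !) * ∑ n (λ k → comp 1 n n (suc k))
  ≡⟨ cong (ℕtoℚ (n !) *_) (ℚₚ.+-identityˡ _) ⟨
    ℕtoℚ (n !) * compTotal n n
  ≡⟨ cong (ℕtoℚ (n !) *_) (compTotal≡F n n ℕₚ.≤-refl) ⟩
    ℕtoℚ (n !) * F (n + r′)
  ≡⟨ cong (λ m → ℕtoℚ (n !) * F (m ∸ 1)) (sym (ℕₚ.+-suc n r′)) ⟩
    ℕtoℚ (n !) * rFib (suc r′) x (n + suc r′ ∸ 1) ∎
  where
  open ≡-Reasoning
  open Compositions (var x)
  open BellToCompositions (factVar x) (var x) (factVar*inv!≡var x)
  open RFibonacci r′ x
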